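{- Let $G$ be a connected simple undirected graph with $|V(G)|=n$ and $|E(G)|=m$. Then \[ \mathscr{K}_e(G)=\mathscr{K}_v(G)+2m-n. \]
   Context: For an irreducible stochastic $N\times N$ matrix $P$ with eigenvalues (complex, listed with algebraic multiplicity) $\rho_1=1,\rho_2,\dots,\rho_N$, Kemeny's constant is $\mathscr{K}(P)=\sum_{i=2}^N \frac{1}{1-\rho_i}$. Equivalently, $\mathscr{K}(P)=\sum_{j\ne i} m_{ij}\pi_j$, where $m_{ij}$ is the mean first passage time from state $i$ to state $j$ and $\pi$ is the stationary distribution; this value does not depend on $i$. For a graph $G$ with adjacency matrix $A$ and diagonal degree matrix $D$, the vertex Kemeny's constant is $\mathscr{K}_v(G)=\mathscr{K}(D^{ -1}A)$, the Kemeny's constant of the simple random walk on the vertices. Let $E'=\{(u,v):\{u,v\}\in E(G)\}$ be the set of $2m$ oriented edges (arcs). The edge-space transition matrix $P_e$ is the $2m\times 2m$ matrix indexed by $E'$ with $P_e((u,v),(x,y))=1/\deg(v)$ if $x=v$, and $0$ otherwise. The edge Kemeny's constant is $\mathscr{K}_e(G)=\mathscr{K}(P_e)$. -}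

module Defs where

open import Data.Bool using (Bool; true; false; T; if_then_else_; not)
open import Data.Nat as ℕ using (ℕ; zero; suc)
open import Data.Integer as ℤ using (ℤ; +_)
open import Data.Fin using (Fin)
open import Data.Fin.Properties using () renaming (_≟_ to _≟ᶠ_)
open import Data.Product using (_×_; _,_; proj₁; proj₂; Σ; ∃)
open import Data.List using (List; []; _∷_; length; map; foldr; filterᵇ; allFin; cartesianProduct)
open import Data.List.Membership.Propositional using (_∈_)
open import Data.Rational as ℚ using (ℚ; 0ℚ; 1ℚ; _+_; _*_; _-_)
open import Relation.Binary.PropositionalEquality using (_≡_)
open import Relation.Binary using (DecidableEquality)
open import Relation.Nullary using (¬_; does)

record Graph (n : ℕ) : Set where
  field
    adj       : Fin n → Fin n → Bool
    symmetric : ∀ u v → adj u v ≡ adj v u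
    loopless  : ∀ v → adj v v ≡ false
open Graph public

data Reach {n : ℕ} (G : Graph n) : Fin n → Fin n → Set where
  here : ∀ {v} → Reach G v v
  step : ∀ {u w v} → T (adj G u w) → Reach G w v → Reach G u v

Connected : ∀ {n} → Graph n → Set
Connected G = ∀ u v → Reach G u v

deg : ∀ {n} → Graph n → Fin n → ℕ
deg {n} G v = length (filterᵇ (adj G v) (allFin n))

-- the list of oriented edges (arcs) E' ; its length is 2m
arcs : ∀ {n} → Graph n → List (Fin n × Fin n)
arcs {n} G = filterᵇ (λ p → adj G (proj₁ p) (proj₂ p)) (cartesianProduct (allFin n) (allFin n))

-- 1/d as a rational, with 1/0 := 0 (only ever applied to positive degrees)
inv : ℕ → ℚ
inv zero    = 0ℚ
inv (suc k) = (+ 1) ℚ./ suc k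

Σ[_]_ : ∀ {S : Set} → List S → (S → ℚ) → ℚ
Σ[ xs ] f = foldr (λ x acc → f x + acc) 0ℚ xs

-- Markov chains on a finite state space given by an enumeration `st`
-- (a duplicate-free list of states), with transition matrix P : S → S → ℚ.

module Chain {S : Set} (_≟_ : DecidableEquality S) (st : List S) (P : S → S → ℚ) where

  Σ≠ : S → (S → ℚ) → ℚ
  Σ≠ j f = Σ[ st ] (λ k → if does (k ≟ j) then 0ℚ else f k)

  Stationary : (S → ℚ) → Set
  Stationary π = (Σ[ st ] π ≡ 1ℚ) × (∀ j → j ∈ st → π j ≡ Σ[ st ] (λ i → π i * P i j))

  -- M i j (i ≠ j) are the mean first passage times: the (unique, for an
  -- irreducible chain) solution of the first-step equations
  -- m_ij = 1 + Σ_{k ≠ j} P_ik m_kj .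
  FirstPassage : (S → S → ℚ) → Set
  FirstPassage M = ∀ i j → i ∈ st → j ∈ st → ¬ (i ≡ j) →
    M i j ≡ 1ℚ + Σ≠ j (λ k → P i k * M k j)

  IsKemeny : ℚ → Set
  IsKemeny K = ∃ λ (π : S → ℚ) → ∃ λ (M : S → S → ℚ) →
    Stationary π × FirstPassage M × (∀ i → i ∈ st → Σ≠ i (λ j → M i j * π j) ≡ K)

Pv : ∀ {n} → Graph n → Fin n → Fin n → ℚ
Pv G u v = if adj G u v then inv (deg G u) else 0ℚ

_≟ᵃ_ : ∀ {n} → DecidableEquality (Fin n × Fin n)
(a , b) ≟ᵃ (c , d) with a ≟ᶠ c | b ≟ᶠ d
... | Relation.Nullary.yes Relation.Binary.PropositionalEquality.refl | Relation.Nullary.yes Relation.Binary.PropositionalEquality.refl = Relation.Nullary.yes Relation.Binary.PropositionalEquality.refl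
... | Relation.Nullary.no ¬p | _ = Relation.Nullary.no λ { Relation.Binary.PropositionalEquality.refl → ¬p Relation.Binary.PropositionalEquality.refl }
... | _ | Relation.Nullary.no ¬q = Relation.Nullary.no λ { Relation.Binary.PropositionalEquality.refl → ¬q Relation.Binary.PropositionalEquality.refl }

Pe : ∀ {n} → Graph n → (Fin n × Fin n) → (Fin n × Fin n) → ℚ
Pe G (u , v) (x , y) = if does (x ≟ᶠ v) then inv (deg G v) else 0ℚ

IsKemenyV : ∀ {n} → Graph n → ℚ → Set
IsKemenyV {n} G = Chain.IsKemeny _≟ᶠ_ (allFin n) (Pv G)

IsKemenyE : ∀ {n} → Graph n → ℚ → Set
IsKemenyE G = Chain.IsKemeny _≟ᵃ_ (arcs G) (Pe G)

twoM-n : ∀ {n} → Graph n → ℚ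
twoM-n {n} G = ((+ length (arcs G)) ℤ.- (+ n)) ℚ./ 1

{-# OPTIONS --safe #-}
-- The degree distribution d(u)/2m is stationary for the vertex walk, so Kac's formula makes the
-- mean return time to x equal to 2m/d(x); by the first-step equation this says that
-- Σ_{b ~ x} m̃(b, x) = 2m − d(x), where m̃ is the matrix of mean first passage times with zero
-- diagonal. On arcs the uniform distribution 1/2m is stationary, and
-- m_e((u, v), (x, y)) = m̃(v, x) + 2m − m̃(y, x) solves the first-step equations of the edge walk,
-- the case v = x being exactly the return-time identity above. Averaging m_e((u, v), ·) against
-- 1/2m gives 𝒦_v + 2m − n. Finally, a maximum principle for functions that are harmonic off one
-- state shows that in an irreducible chain the first passage times, the stationary distribution
-- and hence Kemeny's constant are unique; the edge walk of a connected graph is irreducible.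
module Submission where

open import Defs
open import Data.Bool using (Bool; true; false; T; if_then_else_)
open import Data.Empty using (⊥-elim)
open import Data.Fin as Fin using (Fin)
open import Data.Fin.Properties using () renaming (_≟_ to _≟ᶠ_)
open import Data.Integer as ℤ using (ℤ)
open import Data.Integer.Tactic.RingSolver using () renaming (solve-∀ to ℤ-solve-∀)
open import Data.List using (List; []; _∷_; length; map; filterᵇ; allFin; cartesianProduct; _++_)
open import Data.List.Properties using (length-tabulate)
open import Data.List.Membership.Propositional using (_∈_)
open import Data.List.Membership.Propositional.Properties using (∈-filter⁺; ∈-filter⁻; ∈-cartesianProduct⁺; ∈-allFin)
import Data.List.Relation.Unary.All as All
open import Data.List.Relation.Unary.AllPairs using (_∷_)
open import Data.List.Relation.Unary.Any using (here; there)
open import Data.List.Relation.Unary.Unique.Propositional using (Unique)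
import Data.List.Relation.Unary.Unique.Propositional.Properties as Unique
open import Data.Nat using (ℕ; _≤_)
import Data.Nat as ℕ
import Data.Nat.Properties as ℕ using (≤-trans)
open import Data.Product using (_×_; _,_; proj₁; proj₂; ∃)
open import Data.Rational
  using (ℚ; _+_; 0ℚ; 1ℚ; _*_; _-_; -_; _/_; 1/_; _<_; toℚᵘ; positive; nonNegative)
  renaming (_≤_ to _≤ℚ_)
import Data.Rational.Properties as ℚ
import Data.Rational.Unnormalised as ℚᵘ
import Data.Rational.Unnormalised.Properties as ℚᵘ
open import Function using (id)
open import Level using (0ℓ)
open import Relation.Binary using (DecidableEquality; DecTotalOrder)
open import Data.List.Extrema (DecTotalOrder.totalOrder ℚ.≤-decTotalOrder) using (argmax; argmax-all; f[xs]≤f[argmax])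
open import Relation.Binary.PropositionalEquality
  using (_≡_; refl; sym; trans; cong; cong₂; subst; subst₂; _≢_; module ≡-Reasoning)
open import Relation.Nullary using (does; yes; no; T?)
open import Relation.Nullary.Decidable using (dec-true; dec-false; dec⇒maybe)
open import Tactic.RingSolver using (solve-∀)
open import Tactic.RingSolver.Core.AlmostCommutativeRing using (AlmostCommutativeRing; fromCommutativeRing)

ℚ-ring : AlmostCommutativeRing 0ℓ 0ℓ
ℚ-ring = fromCommutativeRing ℚ.+-*-commutativeRing (λ x → dec⇒maybe (0ℚ ℚ.≟ x))

fromℤ : ℤ → ℚ
fromℤ i = i / 1

fromℕ : ℕ → ℚ
fromℕ k = fromℤ (ℤ.+ k)

toℚᵘ-fromℤ : ∀ i → toℚᵘ (fromℤ i) ℚᵘ.≃ ℚᵘ.mkℚᵘ i 0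
toℚᵘ-fromℤ i = ℚ.toℚᵘ-fromℚᵘ (ℚᵘ.mkℚᵘ i 0)

fromℤ-+ : ∀ i j → fromℤ (i ℤ.+ j) ≡ fromℤ i + fromℤ j
fromℤ-+ i j = ℚ.toℚᵘ-injective (begin
  toℚᵘ (fromℤ (i ℤ.+ j))               ≈⟨ toℚᵘ-fromℤ (i ℤ.+ j) ⟩
  ℚᵘ.mkℚᵘ (i ℤ.+ j) 0                  ≈⟨ ℚᵘ.*≡* (+-over-1 i j) ⟩
  ℚᵘ.mkℚᵘ i 0 ℚᵘ.+ ℚᵘ.mkℚᵘ j 0         ≈⟨ ℚᵘ.+-cong (toℚᵘ-fromℤ i) (toℚᵘ-fromℤ j) ⟨
  toℚᵘ (fromℤ i) ℚᵘ.+ toℚᵘ (fromℤ j)   ≈⟨ ℚ.toℚᵘ-homo-+ (fromℤ i) (fromℤ j) ⟨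
  toℚᵘ (fromℤ i + fromℤ j)             ∎)
  where
  open ℚᵘ.≃-Reasoning
  +-over-1 : ∀ i j → (i ℤ.+ j) ℤ.* (ℤ.+ 1 ℤ.* ℤ.+ 1) ≡ (i ℤ.* ℤ.+ 1 ℤ.+ j ℤ.* ℤ.+ 1) ℤ.* ℤ.+ 1
  +-over-1 = ℤ-solve-∀

fromℤ-neg : ∀ i → fromℤ (ℤ.- i) ≡ - fromℤ i
fromℤ-neg i = ℚ.toℚᵘ-injective (begin
  toℚᵘ (fromℤ (ℤ.- i))     ≈⟨ toℚᵘ-fromℤ (ℤ.- i) ⟩
  ℚᵘ.- ℚᵘ.mkℚᵘ i 0         ≈⟨ ℚᵘ.-‿cong (toℚᵘ-fromℤ i) ⟨
  ℚᵘ.- toℚᵘ (fromℤ i)      ≈⟨ ℚ.toℚᵘ-homo‿- (fromℤ i) ⟨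
  toℚᵘ (- fromℤ i)         ∎)
  where open ℚᵘ.≃-Reasoning

fromℤ-sub : ∀ a b → fromℤ (ℤ.+ a ℤ.- ℤ.+ b) ≡ fromℕ a - fromℕ b
fromℤ-sub a b = trans (fromℤ-+ (ℤ.+ a) (ℤ.- ℤ.+ b)) (cong (fromℕ a +_) (fromℤ-neg (ℤ.+ b)))

fromℕ-suc : ∀ k → fromℕ (ℕ.suc k) ≡ 1ℚ + fromℕ k
fromℕ-suc k = fromℤ-+ (ℤ.+ 1) (ℤ.+ k)

fromℕ-*-inv : ∀ {d} → 0 ℕ.< d → fromℕ d * inv d ≡ 1ℚ
fromℕ-*-inv {ℕ.suc k} _ = ℚ.toℚᵘ-injective (begin
  toℚᵘ (fromℕ (ℕ.suc k) * inv (ℕ.suc k))             ≈⟨ ℚ.toℚᵘ-homo-* (fromℕ (ℕ.suc k)) (inv (ℕ.suc k)) ⟩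
  toℚᵘ (fromℕ (ℕ.suc k)) ℚᵘ.* toℚᵘ (inv (ℕ.suc k))   ≈⟨ ℚᵘ.*-cong (toℚᵘ-fromℤ (ℤ.+ ℕ.suc k)) (ℚ.toℚᵘ-fromℚᵘ (ℚᵘ.mkℚᵘ (ℤ.+ 1) k)) ⟩
  d′ ℚᵘ.* ℚᵘ.1/ d′                                    ≈⟨ ℚᵘ.*-inverseʳ d′ ⟩
  ℚᵘ.1ℚᵘ                                              ∎)
  where
  open ℚᵘ.≃-Reasoning
  d′ = ℚᵘ.mkℚᵘ (ℤ.+ ℕ.suc k) 0

inv-pos : ∀ {d} → 0 ℕ.< d → 0ℚ < inv d
inv-pos {ℕ.suc k} _ = ℚ.positive⁻¹ (inv (ℕ.suc k)) {{ℚ.normalize-pos 1 (ℕ.suc k)}}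

inv-nonneg : ∀ d → 0ℚ ≤ℚ inv d
inv-nonneg ℕ.zero = ℚ.≤-refl
inv-nonneg (ℕ.suc k) = ℚ.<⇒≤ (inv-pos {ℕ.suc k} (ℕ.s≤s ℕ.z≤n))

*-inverse-unique : ∀ {a b r} → a * r ≡ 1ℚ → b * r ≡ 1ℚ → a ≡ b
*-inverse-unique {a} {b} {r} ar≡1 br≡1 = begin
  a            ≡⟨ sym (ℚ.*-identityʳ a) ⟩
  a * 1ℚ       ≡⟨ cong (a *_) (sym br≡1) ⟩
  a * (b * r)  ≡⟨ left-comm a b r ⟩
  b * (a * r)  ≡⟨ cong (b *_) ar≡1 ⟩
  b * 1ℚ       ≡⟨ ℚ.*-identityʳ b ⟩
  b            ∎
  where
  open ≡-Reasoning
  left-comm : ∀ a b r → a * (b * r) ≡ b * (a * r)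
  left-comm = solve-∀ ℚ-ring

pos-*-≡0 : ∀ {a b} → 0ℚ < a → a * b ≡ 0ℚ → b ≡ 0ℚ
pos-*-≡0 {a} {b} 0<a ab≡0 = begin
  b                  ≡⟨ sym (ℚ.*-identityˡ b) ⟩
  1ℚ * b             ≡⟨ cong (_* b) (ℚ.*-inverseˡ a) ⟨
  1/a * a * b        ≡⟨ ℚ.*-assoc 1/a a b ⟩
  1/a * (a * b)      ≡⟨ cong (1/a *_) ab≡0 ⟩
  1/a * 0ℚ           ≡⟨ ℚ.*-zeroʳ 1/a ⟩
  0ℚ                 ∎
  where
  open ≡-Reasoning
  instance _ = ℚ.pos⇒nonZero a {{positive 0<a}}
  1/a = 1/ a

nonneg-+-≡0ˡ : ∀ {a b} → 0ℚ ≤ℚ a → 0ℚ ≤ℚ b → a + b ≡ 0ℚ → a ≡ 0ℚ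
nonneg-+-≡0ˡ {a} {b} 0≤a 0≤b a+b≡0 = ℚ.≤-antisym a≤0 0≤a
  where
  a≤0 : a ≤ℚ 0ℚ
  a≤0 = subst₂ _≤ℚ_ (ℚ.+-identityʳ a) a+b≡0 (ℚ.+-monoʳ-≤ a 0≤b)

nonneg-*-nonneg : ∀ {a b} → 0ℚ ≤ℚ a → 0ℚ ≤ℚ b → 0ℚ ≤ℚ a * b
nonneg-*-nonneg {a} {b} 0≤a 0≤b =
  ℚ.nonNegative⁻¹ (a * b) {{ℚ.nonNeg*nonNeg⇒nonNeg a {{nonNegative 0≤a}} b {{nonNegative 0≤b}}}}

≤⇒0≤- : ∀ {a b} → a ≤ℚ b → 0ℚ ≤ℚ b - a
≤⇒0≤- {a} {b} a≤b = subst (_≤ℚ b - a) (ℚ.+-inverseʳ a) (ℚ.+-monoˡ-≤ (- a) a≤b)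

-≡0⇒≡ : ∀ {a b} → a - b ≡ 0ℚ → a ≡ b
-≡0⇒≡ {a} {b} a-b≡0 = trans (sub-add a b) (trans (cong (_+ b) a-b≡0) (ℚ.+-identityˡ b))
  where
  sub-add : ∀ a b → a ≡ (a - b) + b
  sub-add = solve-∀ ℚ-ring

if-split : ∀ b (x : ℚ) → x ≡ (if b then x else 0ℚ) + (if b then 0ℚ else x)
if-split true  x = sym (ℚ.+-identityʳ x)
if-split false x = sym (ℚ.+-identityˡ x)

if-then-* : ∀ b (x y : ℚ) → (if b then x else 0ℚ) * y ≡ (if b then x * y else 0ℚ)
if-then-* true  x y = refl
if-then-* false x y = ℚ.*-zeroˡ y

if-else-* : ∀ b (x y : ℚ) → (if b then 0ℚ else x) * y ≡ (if b then 0ℚ else x * y)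
if-else-* true  x y = ℚ.*-zeroˡ y
if-else-* false x y = refl

*-if-then : ∀ b (x y : ℚ) → x * (if b then y else 0ℚ) ≡ (if b then x * y else 0ℚ)
*-if-then true  x y = refl
*-if-then false x y = ℚ.*-zeroʳ x

*-if-else : ∀ b (x y : ℚ) → x * (if b then 0ℚ else y) ≡ (if b then 0ℚ else x * y)
*-if-else true  x y = ℚ.*-zeroʳ x
*-if-else false x y = refl

module _ {S : Set} where

  Σ-cong-∈ : ∀ (xs : List S) {f g : S → ℚ} → (∀ x → x ∈ xs → f x ≡ g x) → Σ[ xs ] f ≡ Σ[ xs ] g
  Σ-cong-∈ []       f≡g = refl
  Σ-cong-∈ (x ∷ xs) f≡g = cong₂ _+_ (f≡g x (here refl)) (Σ-cong-∈ xs (λ y y∈ → f≡g y (there y∈)))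

  Σ-cong : ∀ (xs : List S) {f g : S → ℚ} → (∀ x → f x ≡ g x) → Σ[ xs ] f ≡ Σ[ xs ] g
  Σ-cong xs f≡g = Σ-cong-∈ xs (λ x _ → f≡g x)

  Σ-zero : ∀ (xs : List S) → Σ[ xs ] (λ _ → 0ℚ) ≡ 0ℚ
  Σ-zero []       = refl
  Σ-zero (x ∷ xs) = trans (ℚ.+-identityˡ _) (Σ-zero xs)

  Σ-+ : ∀ (xs : List S) f g → Σ[ xs ] (λ x → f x + g x) ≡ Σ[ xs ] f + Σ[ xs ] g
  Σ-+ []       f g = refl
  Σ-+ (x ∷ xs) f g = trans (cong (f x + g x +_) (Σ-+ xs f g)) (interchange (f x) (g x) (Σ[ xs ] f) (Σ[ xs ] g))
    where
    interchange : ∀ a b c d → (a + b) + (c + d) ≡ (a + c) + (b + d)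
    interchange = solve-∀ ℚ-ring

  Σ-*ˡ : ∀ (xs : List S) c f → Σ[ xs ] (λ x → c * f x) ≡ c * Σ[ xs ] f
  Σ-*ˡ []       c f = sym (ℚ.*-zeroʳ c)
  Σ-*ˡ (x ∷ xs) c f = trans (cong (c * f x +_) (Σ-*ˡ xs c f)) (sym (ℚ.*-distribˡ-+ c (f x) _))

  Σ-*ʳ : ∀ (xs : List S) c f → Σ[ xs ] (λ x → f x * c) ≡ Σ[ xs ] f * c
  Σ-*ʳ xs c f = trans (Σ-cong xs (λ x → ℚ.*-comm (f x) c)) (trans (Σ-*ˡ xs c f) (ℚ.*-comm c _))

  Σ-neg : ∀ (xs : List S) f → Σ[ xs ] (λ x → - f x) ≡ - Σ[ xs ] f
  Σ-neg []       f = refl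
  Σ-neg (x ∷ xs) f = trans (cong (- f x +_) (Σ-neg xs f)) (sym (ℚ.neg-distrib-+ (f x) _))

  Σ-- : ∀ (xs : List S) f g → Σ[ xs ] (λ x → f x - g x) ≡ Σ[ xs ] f - Σ[ xs ] g
  Σ-- xs f g = trans (Σ-+ xs f (λ x → - g x)) (cong (Σ[ xs ] f +_) (Σ-neg xs g))

  Σ-const : ∀ (xs : List S) c → Σ[ xs ] (λ _ → c) ≡ fromℕ (length xs) * c
  Σ-const []       c = sym (ℚ.*-zeroˡ c)
  Σ-const (x ∷ xs) c = begin
    c + Σ[ xs ] (λ _ → c)            ≡⟨ cong (c +_) (Σ-const xs c) ⟩
    c + fromℕ (length xs) * c        ≡⟨ factor c (fromℕ (length xs)) ⟩
    (1ℚ + fromℕ (length xs)) * c     ≡⟨ cong (_* c) (fromℕ-suc (length xs)) ⟨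
    fromℕ (ℕ.suc (length xs)) * c    ∎
    where
    open ≡-Reasoning
    factor : ∀ c l → c + l * c ≡ (1ℚ + l) * c
    factor = solve-∀ ℚ-ring

  Σ-++ : ∀ (xs ys : List S) f → Σ[ xs ++ ys ] f ≡ Σ[ xs ] f + Σ[ ys ] f
  Σ-++ []       ys f = sym (ℚ.+-identityˡ _)
  Σ-++ (x ∷ xs) ys f = trans (cong (f x +_) (Σ-++ xs ys f)) (sym (ℚ.+-assoc (f x) _ _))

  Σ-filterᵇ : ∀ (p : S → Bool) (xs : List S) f →
    Σ[ filterᵇ p xs ] f ≡ Σ[ xs ] (λ x → if p x then f x else 0ℚ)
  Σ-filterᵇ p []       f = refl
  Σ-filterᵇ p (x ∷ xs) f with p x
  ... | true  = cong (f x +_) (Σ-filterᵇ p xs f)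
  ... | false = trans (Σ-filterᵇ p xs f) (sym (ℚ.+-identityˡ _))

  Σ-nonneg : ∀ (xs : List S) {f} → (∀ x → x ∈ xs → 0ℚ ≤ℚ f x) → 0ℚ ≤ℚ Σ[ xs ] f
  Σ-nonneg []       0≤f = ℚ.≤-refl
  Σ-nonneg (x ∷ xs) 0≤f = ℚ.+-mono-≤ (0≤f x (here refl)) (Σ-nonneg xs (λ y y∈ → 0≤f y (there y∈)))

  Σ-nonneg-≡0 : ∀ (xs : List S) {f} → (∀ x → x ∈ xs → 0ℚ ≤ℚ f x) → Σ[ xs ] f ≡ 0ℚ →
                ∀ x → x ∈ xs → f x ≡ 0ℚ
  Σ-nonneg-≡0 (y ∷ xs) {f} 0≤f Σ≡0 x x∈ = go x∈
    where
    0≤Σxs = Σ-nonneg xs (λ z z∈ → 0≤f z (there z∈))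
    0≤fy  = 0≤f y (here refl)
    go : x ∈ y ∷ xs → f x ≡ 0ℚ
    go (here refl) = nonneg-+-≡0ˡ 0≤fy 0≤Σxs Σ≡0
    go (there x∈)  = Σ-nonneg-≡0 xs (λ z z∈ → 0≤f z (there z∈))
      (nonneg-+-≡0ˡ 0≤Σxs 0≤fy (trans (ℚ.+-comm _ (f y)) Σ≡0)) x x∈

Σ-map : ∀ {A B : Set} (g : A → B) (xs : List A) f → Σ[ map g xs ] f ≡ Σ[ xs ] (λ x → f (g x))
Σ-map g []       f = refl
Σ-map g (x ∷ xs) f = cong (f (g x) +_) (Σ-map g xs f)

module _ {A B : Set} where

  Σ-swap : ∀ (xs : List A) (ys : List B) (f : A → B → ℚ) →
    Σ[ xs ] (λ x → Σ[ ys ] (f x)) ≡ Σ[ ys ] (λ y → Σ[ xs ] (λ x → f x y))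
  Σ-swap []       ys f = sym (Σ-zero ys)
  Σ-swap (x ∷ xs) ys f = trans (cong (Σ[ ys ] (f x) +_) (Σ-swap xs ys f))
    (sym (Σ-+ ys (f x) (λ y → Σ[ xs ] (λ x′ → f x′ y))))

  Σ-cartesianProduct : ∀ (xs : List A) (ys : List B) (f : A × B → ℚ) →
    Σ[ cartesianProduct xs ys ] f ≡ Σ[ xs ] (λ x → Σ[ ys ] (λ y → f (x , y)))
  Σ-cartesianProduct []       ys f = refl
  Σ-cartesianProduct (x ∷ xs) ys f = trans (Σ-++ (map (x ,_) ys) _ f)
    (cong₂ _+_ (Σ-map (x ,_) ys f) (Σ-cartesianProduct xs ys f))

module _ {S : Set} (_≟_ : DecidableEquality S) where

  if-≟-≡ : ∀ {i j : S} {A : Set} {x y : A} → i ≡ j → (if does (i ≟ j) then x else y) ≡ x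
  if-≟-≡ {i} {j} i≡j = cong (if_then _ else _) (dec-true (i ≟ j) i≡j)

  if-≟-≢ : ∀ {i j : S} {A : Set} {x y : A} → i ≢ j → (if does (i ≟ j) then x else y) ≡ y
  if-≟-≢ {i} {j} i≢j = cong (if_then _ else _) (dec-false (i ≟ j) i≢j)

  does-≟-sym : ∀ i j → does (i ≟ j) ≡ does (j ≟ i)
  does-≟-sym i j with i ≟ j | j ≟ i
  ... | yes _   | yes _   = refl
  ... | no  _   | no  _   = refl
  ... | yes i≡j | no  j≢i = ⊥-elim (j≢i (sym i≡j))
  ... | no  i≢j | yes j≡i = ⊥-elim (i≢j (sym j≡i))

  Σ-δ : ∀ {xs} → Unique xs → ∀ {j} → j ∈ xs → (f : S → ℚ) →
        Σ[ xs ] (λ i → if does (i ≟ j) then f i else 0ℚ) ≡ f j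
  Σ-δ {x ∷ xs} (x≢xs ∷ _) (here refl) f = begin
    (if does (x ≟ x) then f x else 0ℚ) + Σ[ xs ] (λ i → if does (i ≟ x) then f i else 0ℚ)
      ≡⟨ cong₂ _+_ (if-≟-≡ refl) (Σ-cong-∈ xs (λ i i∈ → if-≟-≢ (λ i≡x → All.lookup x≢xs i∈ (sym i≡x)))) ⟩
    f x + Σ[ xs ] (λ _ → 0ℚ)  ≡⟨ cong (f x +_) (Σ-zero xs) ⟩
    f x + 0ℚ                  ≡⟨ ℚ.+-identityʳ (f x) ⟩
    f x                       ∎
    where open ≡-Reasoning
  Σ-δ {x ∷ xs} (x≢xs ∷ xs-unique) {j} (there j∈) f = begin
    (if does (x ≟ j) then f x else 0ℚ) + Σ[ xs ] (λ i → if does (i ≟ j) then f i else 0ℚ)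
      ≡⟨ cong₂ _+_ (if-≟-≢ (All.lookup x≢xs j∈)) (Σ-δ xs-unique j∈ f) ⟩
    0ℚ + f j  ≡⟨ ℚ.+-identityˡ (f j) ⟩
    f j       ∎
    where open ≡-Reasoning

  Σ-δ′ : ∀ {xs} → Unique xs → ∀ {j} → j ∈ xs → (f : S → ℚ) →
         Σ[ xs ] (λ i → if does (j ≟ i) then f i else 0ℚ) ≡ f j
  Σ-δ′ {xs} xs-unique {j} j∈ f = trans (Σ-cong xs (λ i → cong (if_then f i else 0ℚ) (does-≟-sym j i))) (Σ-δ xs-unique j∈ f)

module MarkovChain {S : Set} (_≟_ : DecidableEquality S) (st : List S) (st-unique : Unique st)
                   (P : S → S → ℚ) where

  open Chain _≟_ st P public

  -- FirstPassage constrains only the off-diagonal entries of M; its diagonal is arbitrary.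
  offDiag : (S → S → ℚ) → S → S → ℚ
  offDiag M i j = if does (i ≟ j) then 0ℚ else M i j

  Σ-split≠ : ∀ {j} → j ∈ st → (f : S → ℚ) → Σ[ st ] f ≡ f j + Σ≠ j f
  Σ-split≠ {j} j∈ f = begin
    Σ[ st ] f
      ≡⟨ Σ-cong st (λ i → if-split (does (i ≟ j)) (f i)) ⟩
    Σ[ st ] (λ i → (if does (i ≟ j) then f i else 0ℚ) + (if does (i ≟ j) then 0ℚ else f i))
      ≡⟨ Σ-+ st (λ i → if does (i ≟ j) then f i else 0ℚ) (λ i → if does (i ≟ j) then 0ℚ else f i) ⟩
    Σ[ st ] (λ i → if does (i ≟ j) then f i else 0ℚ) + Σ≠ j f
      ≡⟨ cong (_+ Σ≠ j f) (Σ-δ _≟_ st-unique j∈ f) ⟩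
    f j + Σ≠ j f ∎
    where open ≡-Reasoning

  Σ≠≡Σ- : ∀ {j} → j ∈ st → (f : S → ℚ) → Σ≠ j f ≡ Σ[ st ] f - f j
  Σ≠≡Σ- {j} j∈ f = trans (add-sub (Σ≠ j f) (f j)) (cong (_- f j) (sym (Σ-split≠ j∈ f)))
    where
    add-sub : ∀ a b → a ≡ (b + a) - b
    add-sub = solve-∀ ℚ-ring

  Σ≠-offDiag : ∀ j (f : S → ℚ) M → Σ≠ j (λ k → f k * M k j) ≡ Σ[ st ] (λ k → f k * offDiag M k j)
  Σ≠-offDiag j f M = Σ-cong st (λ k → sym (*-if-else (does (k ≟ j)) (f k) (M k j)))

  Σ≠-offDiagʳ : ∀ i (g : S → ℚ) M → Σ≠ i (λ j → M i j * g j) ≡ Σ[ st ] (λ j → offDiag M i j * g j)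
  Σ≠-offDiagʳ i g M = Σ-cong st λ j → begin
    (if does (j ≟ i) then 0ℚ else M i j * g j)  ≡⟨ cong (if_then 0ℚ else M i j * g j) (does-≟-sym _≟_ j i) ⟩
    (if does (i ≟ j) then 0ℚ else M i j * g j)  ≡⟨ if-else-* (does (i ≟ j)) (M i j) (g j) ⟨
    offDiag M i j * g j                         ∎
    where
    open ≡-Reasoning

  firstPassage-offDiag : ∀ {M} → FirstPassage M → ∀ {i j} → i ∈ st → j ∈ st → i ≢ j →
    M i j ≡ 1ℚ + Σ[ st ] (λ k → P i k * offDiag M k j)
  firstPassage-offDiag {M} fp {i} {j} i∈ j∈ i≢j =
    trans (fp i j i∈ j∈ i≢j) (cong (1ℚ +_) (Σ≠-offDiag j (P i) M))

  stationary-Σ : ∀ {π} → Stationary π → (g : S → ℚ) →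
    Σ[ st ] (λ i → π i * Σ[ st ] (λ k → P i k * g k)) ≡ Σ[ st ] (λ k → π k * g k)
  stationary-Σ {π} (_ , π≡πP) g = begin
    Σ[ st ] (λ i → π i * Σ[ st ] (λ k → P i k * g k))
      ≡⟨ Σ-cong st (λ i → sym (Σ-*ˡ st (π i) _)) ⟩
    Σ[ st ] (λ i → Σ[ st ] (λ k → π i * (P i k * g k)))
      ≡⟨ Σ-swap st st (λ i k → π i * (P i k * g k)) ⟩
    Σ[ st ] (λ k → Σ[ st ] (λ i → π i * (P i k * g k)))
      ≡⟨ Σ-cong st (λ k → trans (Σ-cong st (λ i → sym (ℚ.*-assoc (π i) (P i k) (g k)))) (Σ-*ʳ st (g k) (λ i → π i * P i k))) ⟩
    Σ[ st ] (λ k → Σ[ st ] (λ i → π i * P i k) * g k)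
      ≡⟨ Σ-cong-∈ st (λ k k∈ → cong (_* g k) (sym (π≡πP k k∈))) ⟩
    Σ[ st ] (λ k → π k * g k) ∎
    where open ≡-Reasoning

  returnTime : (S → S → ℚ) → S → ℚ
  returnTime M j = 1ℚ + Σ[ st ] (λ k → P j k * offDiag M k j)

  -- Kac's formula: Σᵢ πᵢ Rᵢ is evaluated once by stationarity and once by the first-passage
  -- equations, which say Rᵢ = M i j for i ≢ j.
  stationary-*-returnTime : ∀ {π M} → Stationary π → FirstPassage M → ∀ {j} → j ∈ st →
    π j * returnTime M j ≡ 1ℚ
  stationary-*-returnTime {π} {M} stat@(Σπ≡1 , _) fp {j} j∈ = +-cancelʳ (trans (sym by-firstPassage) by-stationarity)
    where
    open ≡-Reasoning
    R : S → ℚ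
    R i = 1ℚ + Σ[ st ] (λ k → P i k * offDiag M k j)
    B : ℚ
    B = Σ[ st ] (λ k → π k * offDiag M k j)
    by-stationarity : Σ[ st ] (λ i → π i * R i) ≡ 1ℚ + B
    by-stationarity = begin
      Σ[ st ] (λ i → π i * R i)
        ≡⟨ Σ-cong st (λ i → ℚ.*-distribˡ-+ (π i) 1ℚ _) ⟩
      Σ[ st ] (λ i → π i * 1ℚ + π i * Σ[ st ] (λ k → P i k * offDiag M k j))
        ≡⟨ Σ-+ st (λ i → π i * 1ℚ) (λ i → π i * Σ[ st ] (λ k → P i k * offDiag M k j)) ⟩
      Σ[ st ] (λ i → π i * 1ℚ) + Σ[ st ] (λ i → π i * Σ[ st ] (λ k → P i k * offDiag M k j))
        ≡⟨ cong₂ _+_ (trans (Σ-cong st (λ i → ℚ.*-identityʳ (π i))) Σπ≡1) (stationary-Σ stat (λ k → offDiag M k j)) ⟩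
      1ℚ + B ∎
    pointwise : ∀ i → i ∈ st → π i * R i ≡ (if does (i ≟ j) then π i * R i else 0ℚ) + π i * offDiag M i j
    pointwise i i∈ with i ≟ j
    ... | yes refl = sym (trans (cong (π i * R i +_) (ℚ.*-zeroʳ (π i))) (ℚ.+-identityʳ _))
    ... | no  i≢j  = trans (cong (π i *_) (sym (firstPassage-offDiag fp i∈ j∈ i≢j))) (sym (ℚ.+-identityˡ _))
    by-firstPassage : Σ[ st ] (λ i → π i * R i) ≡ π j * R j + B
    by-firstPassage = trans (Σ-cong-∈ st pointwise)
      (trans (Σ-+ st (λ i → if does (i ≟ j) then π i * R i else 0ℚ) (λ i → π i * offDiag M i j)) (cong (_+ B) (Σ-δ _≟_ st-unique j∈ (λ i → π i * R i))))
    +-cancelʳ : ∀ {a b c} → a + c ≡ b + c → a ≡ b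
    +-cancelʳ {a} {b} {c} eq = trans (add-sub a c) (trans (cong (_- c) eq) (sym (add-sub b c)))
      where
      add-sub : ∀ a c → a ≡ (a + c) - c
      add-sub = solve-∀ ℚ-ring

  stationary-unique : ∀ {π₁ π₂ M} → Stationary π₁ → Stationary π₂ → FirstPassage M →
    ∀ {j} → j ∈ st → π₁ j ≡ π₂ j
  stationary-unique stat₁ stat₂ fp j∈ =
    *-inverse-unique (stationary-*-returnTime stat₁ fp j∈) (stationary-*-returnTime stat₂ fp j∈)

  data Path : S → S → Set where
    done : ∀ {i} → Path i i
    step : ∀ {i k j} → k ∈ st → 0ℚ < P i k → Path k j → Path i j

  HarmonicOff : S → (S → ℚ) → Set
  HarmonicOff j h = ∀ i → i ∈ st → i ≢ j → h i ≡ Σ[ st ] (λ k → P i k * h k)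

  module Irreducible (P-nonneg : ∀ i k → i ∈ st → k ∈ st → 0ℚ ≤ℚ P i k)
                     (P-stochastic : ∀ i → i ∈ st → Σ[ st ] (P i) ≡ 1ℚ)
                     (path : ∀ i j → i ∈ st → j ∈ st → Path i j) where

    -- Σₖ P w k · (c − h k) = c − h w = 0 is a sum of non-negative terms.
    maximum-spreads : ∀ {j h c} → HarmonicOff j h → (∀ k → k ∈ st → h k ≤ℚ c) →
      ∀ {w k} → w ∈ st → w ≢ j → h w ≡ c → k ∈ st → 0ℚ < P w k → h k ≡ c
    maximum-spreads {j} {h} {c} harm h≤c {w} {k} w∈ w≢j hw≡c k∈ 0<Pwk =
      sym (-≡0⇒≡ (pos-*-≡0 0<Pwk (Σ-nonneg-≡0 st terms-nonneg terms-sum k k∈)))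
      where
      open ≡-Reasoning
      terms-nonneg : ∀ x → x ∈ st → 0ℚ ≤ℚ P w x * (c - h x)
      terms-nonneg x x∈ = nonneg-*-nonneg (P-nonneg w x w∈ x∈) (≤⇒0≤- (h≤c x x∈))
      terms-sum : Σ[ st ] (λ x → P w x * (c - h x)) ≡ 0ℚ
      terms-sum = begin
        Σ[ st ] (λ x → P w x * (c - h x))          ≡⟨ Σ-cong st (λ x → expand (P w x) c (h x)) ⟩
        Σ[ st ] (λ x → c * P w x - P w x * h x)    ≡⟨ Σ-- st (λ x → c * P w x) (λ x → P w x * h x) ⟩
        Σ[ st ] (λ x → c * P w x) - Σ[ st ] (λ x → P w x * h x)
          ≡⟨ cong₂ _-_ (trans (Σ-*ˡ st c (P w)) (cong (c *_) (P-stochastic w w∈))) (sym (harm w w∈ w≢j)) ⟩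
        c * 1ℚ - h w                                ≡⟨ cong (λ z → c * 1ℚ - z) hw≡c ⟩
        c * 1ℚ - c                                  ≡⟨ cancel c ⟩
        0ℚ ∎
        where
        expand : ∀ p c x → p * (c - x) ≡ c * p - p * x
        expand = solve-∀ ℚ-ring
        cancel : ∀ c → c * 1ℚ - c ≡ 0ℚ
        cancel = solve-∀ ℚ-ring

    maximum-reaches : ∀ {j h c} → HarmonicOff j h → (∀ k → k ∈ st → h k ≤ℚ c) →
      ∀ {w} → Path w j → w ∈ st → h w ≡ c → h j ≡ c
    maximum-reaches harm h≤c done w∈ hw≡c = hw≡c
    maximum-reaches {j} harm h≤c {w} (step k∈ 0<Pwk k⇝j) w∈ hw≡c with w ≟ j
    ... | yes refl = hw≡c
    ... | no  w≢j  = maximum-reaches harm h≤c k⇝j k∈ (maximum-spreads harm h≤c w∈ w≢j hw≡c k∈ 0<Pwk)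

    harmonic-≤ : ∀ {j h} → HarmonicOff j h → j ∈ st → ∀ {i} → i ∈ st → h i ≤ℚ h j
    harmonic-≤ {j} {h} harm j∈ {i} i∈ = subst (h i ≤ℚ_) hm≡hj (h≤hm i i∈)
      where
      m = argmax h i st
      m∈ : m ∈ st
      m∈ = argmax-all h i∈ (All.tabulate (λ x∈ → x∈))
      h≤hm : ∀ k → k ∈ st → h k ≤ℚ h m
      h≤hm k k∈ = All.lookup (f[xs]≤f[argmax] i st) k∈
      hm≡hj : h m ≡ h j
      hm≡hj = sym (maximum-reaches harm h≤hm (path m j m∈ j∈) m∈ refl)

    harmonic-≡ : ∀ {j h} → HarmonicOff j h → j ∈ st → ∀ {i} → i ∈ st → h i ≡ h j
    harmonic-≡ {j} {h} harm j∈ {i} i∈ = ℚ.≤-antisym (harmonic-≤ harm j∈ i∈)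
      (subst₂ _≤ℚ_ (neg-involutive (h j)) (neg-involutive (h i)) (ℚ.neg-antimono-≤ (harmonic-≤ harm⁻ j∈ i∈)))
      where
      harm⁻ : HarmonicOff j (λ x → - h x)
      harm⁻ i i∈ i≢j = trans (cong -_ (harm i i∈ i≢j))
        (trans (sym (Σ-neg st (λ k → P i k * h k))) (Σ-cong st (λ k → ℚ.neg-distribʳ-* (P i k) (h k))))
      neg-involutive : ∀ a → - (- a) ≡ a
      neg-involutive = solve-∀ ℚ-ring

    offDiag-unique : ∀ {M₁ M₂} → FirstPassage M₁ → FirstPassage M₂ →
      ∀ {i j} → i ∈ st → j ∈ st → offDiag M₁ i j ≡ offDiag M₂ i j
    offDiag-unique {M₁} {M₂} fp₁ fp₂ {i} {j} i∈ j∈ = -≡0⇒≡ (trans (harmonic-≡ harm j∈ i∈) hj≡0)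
      where
      open ≡-Reasoning
      h : S → ℚ
      h x = offDiag M₁ x j - offDiag M₂ x j
      hj≡0 : h j ≡ 0ℚ
      hj≡0 = cong₂ _-_ (if-≟-≡ _≟_ refl) (if-≟-≡ _≟_ refl)
      harm : HarmonicOff j h
      harm x x∈ x≢j = begin
        h x
          ≡⟨ cong₂ _-_ (trans (if-≟-≢ _≟_ x≢j) (firstPassage-offDiag fp₁ x∈ j∈ x≢j))
                       (trans (if-≟-≢ _≟_ x≢j) (firstPassage-offDiag fp₂ x∈ j∈ x≢j)) ⟩
        (1ℚ + Σ[ st ] (λ k → P x k * offDiag M₁ k j)) - (1ℚ + Σ[ st ] (λ k → P x k * offDiag M₂ k j))
          ≡⟨ cancel-1 (Σ[ st ] (λ k → P x k * offDiag M₁ k j)) (Σ[ st ] (λ k → P x k * offDiag M₂ k j)) ⟩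
        Σ[ st ] (λ k → P x k * offDiag M₁ k j) - Σ[ st ] (λ k → P x k * offDiag M₂ k j)
          ≡⟨ Σ-- st (λ k → P x k * offDiag M₁ k j) (λ k → P x k * offDiag M₂ k j) ⟨
        Σ[ st ] (λ k → P x k * offDiag M₁ k j - P x k * offDiag M₂ k j)
          ≡⟨ Σ-cong st (λ k → factor (P x k) (offDiag M₁ k j) (offDiag M₂ k j)) ⟩
        Σ[ st ] (λ k → P x k * h k) ∎
        where
        cancel-1 : ∀ a b → (1ℚ + a) - (1ℚ + b) ≡ a - b
        cancel-1 = solve-∀ ℚ-ring
        factor : ∀ p a b → p * a - p * b ≡ p * (a - b)
        factor = solve-∀ ℚ-ring

    kemeny-unique : ∀ {K₁ K₂} → IsKemeny K₁ → IsKemeny K₂ → ∀ {i} → i ∈ st → K₁ ≡ K₂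
    kemeny-unique {K₁} {K₂} (π₁ , M₁ , stat₁ , fp₁ , K₁≡) (π₂ , M₂ , stat₂ , fp₂ , K₂≡) {i} i∈ = begin
      K₁                                      ≡⟨ K₁≡ i i∈ ⟨
      Σ≠ i (λ j → M₁ i j * π₁ j)              ≡⟨ Σ≠-offDiagʳ i π₁ M₁ ⟩
      Σ[ st ] (λ j → offDiag M₁ i j * π₁ j)
        ≡⟨ Σ-cong-∈ st (λ j j∈ → cong₂ _*_ (offDiag-unique fp₁ fp₂ i∈ j∈) (stationary-unique stat₁ stat₂ fp₁ j∈)) ⟩
      Σ[ st ] (λ j → offDiag M₂ i j * π₂ j)   ≡⟨ Σ≠-offDiagʳ i π₂ M₂ ⟨
      Σ≠ i (λ j → M₂ i j * π₂ j)              ≡⟨ K₂≡ i i∈ ⟩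
      K₂                                      ∎
      where open ≡-Reasoning

∈⇒0<length : ∀ {A : Set} {x : A} {xs : List A} → x ∈ xs → 0 ℕ.< length xs
∈⇒0<length (here _)  = ℕ.s≤s ℕ.z≤n
∈⇒0<length (there _) = ℕ.s≤s ℕ.z≤n

connected⇒neighbour : ∀ {n} (G : Graph n) → 2 ≤ n → Connected G → ∀ u → ∃ λ v → T (adj G u v)
connected⇒neighbour {ℕ.suc (ℕ.suc _)} G (ℕ.s≤s (ℕ.s≤s ℕ.z≤n)) conn Fin.zero with conn Fin.zero (Fin.suc Fin.zero)
... | step {w = v} u~v _ = v , u~v
connected⇒neighbour {ℕ.suc (ℕ.suc _)} G (ℕ.s≤s (ℕ.s≤s ℕ.z≤n)) conn (Fin.suc u) with conn (Fin.suc u) Fin.zero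
... | step {w = v} u~v _ = v , u~v

module _ {n : ℕ} (G : Graph n) where

  neighbours : Fin n → List (Fin n)
  neighbours u = filterᵇ (adj G u) (allFin n)

  ∈-arcs⁺ : ∀ {u v} → T (adj G u v) → (u , v) ∈ arcs G
  ∈-arcs⁺ {u} {v} u~v = ∈-filter⁺ (λ a → T? (adj G (proj₁ a) (proj₂ a)))
    (∈-cartesianProduct⁺ (∈-allFin u) (∈-allFin v)) u~v

  ∈-arcs⁻ : ∀ {u v} → (u , v) ∈ arcs G → T (adj G u v)
  ∈-arcs⁻ a∈ = proj₂ (∈-filter⁻ (λ a → T? (adj G (proj₁ a) (proj₂ a)))
    {xs = cartesianProduct (allFin n) (allFin n)} a∈)

  arcs-unique : Unique (arcs G)
  arcs-unique = Unique.filter⁺ (λ a → T? (adj G (proj₁ a) (proj₂ a)))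
    (Unique.cartesianProduct⁺ (Unique.allFin⁺ n) (Unique.allFin⁺ n))

  adj⇒0<deg : ∀ {u v} → T (adj G u v) → 0 ℕ.< deg G u
  adj⇒0<deg {u} {v} u~v = ∈⇒0<length (∈-filter⁺ (λ w → T? (adj G u w)) (∈-allFin v) u~v)

  Σ-arcs-adj : ∀ (H : Fin n × Fin n → ℚ) →
    Σ[ arcs G ] H ≡ Σ[ allFin n ] (λ u → Σ[ allFin n ] (λ v → if adj G u v then H (u , v) else 0ℚ))
  Σ-arcs-adj H = trans (Σ-filterᵇ (λ a → adj G (proj₁ a) (proj₂ a)) (cartesianProduct (allFin n) (allFin n)) H)
    (Σ-cartesianProduct (allFin n) (allFin n) (λ a → if adj G (proj₁ a) (proj₂ a) then H a else 0ℚ))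

  Σ-arcs : ∀ (H : Fin n × Fin n → ℚ) →
    Σ[ arcs G ] H ≡ Σ[ allFin n ] (λ u → Σ[ neighbours u ] (λ v → H (u , v)))
  Σ-arcs H = trans (Σ-arcs-adj H) (Σ-cong (allFin n) (λ u → sym (Σ-filterᵇ (adj G u) (allFin n) (λ v → H (u , v)))))

  Σ-arcs-swap : ∀ (H : Fin n × Fin n → ℚ) → Σ[ arcs G ] H ≡ Σ[ arcs G ] (λ a → H (proj₂ a , proj₁ a))
  Σ-arcs-swap H = begin
    Σ[ arcs G ] H
      ≡⟨ Σ-arcs-adj H ⟩
    Σ[ allFin n ] (λ u → Σ[ allFin n ] (λ v → if adj G u v then H (u , v) else 0ℚ))
      ≡⟨ Σ-swap (allFin n) (allFin n) (λ u v → if adj G u v then H (u , v) else 0ℚ) ⟩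
    Σ[ allFin n ] (λ v → Σ[ allFin n ] (λ u → if adj G u v then H (u , v) else 0ℚ))
      ≡⟨ Σ-cong (allFin n) (λ v → Σ-cong (allFin n) (λ u → cong (if_then H (u , v) else 0ℚ) (symmetric G u v))) ⟩
    Σ[ allFin n ] (λ v → Σ[ allFin n ] (λ u → if adj G v u then H (u , v) else 0ℚ))
      ≡⟨ Σ-arcs-adj (λ a → H (proj₂ a , proj₁ a)) ⟨
    Σ[ arcs G ] (λ a → H (proj₂ a , proj₁ a)) ∎
    where open ≡-Reasoning

  Σ-arcs-source : ∀ (g : Fin n → ℚ) → Σ[ arcs G ] (λ a → g (proj₁ a)) ≡ Σ[ allFin n ] (λ u → fromℕ (deg G u) * g u)
  Σ-arcs-source g = trans (Σ-arcs (λ a → g (proj₁ a))) (Σ-cong (allFin n) (λ u → Σ-const (neighbours u) (g u)))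

  Σ-arcs-target : ∀ (g : Fin n → ℚ) → Σ[ arcs G ] (λ a → g (proj₂ a)) ≡ Σ[ allFin n ] (λ v → fromℕ (deg G v) * g v)
  Σ-arcs-target g = trans (Σ-arcs-swap (λ a → g (proj₂ a))) (Σ-arcs-source g)

  handshake : fromℕ (length (arcs G)) ≡ Σ[ allFin n ] (λ u → fromℕ (deg G u))
  handshake = begin
    fromℕ (length (arcs G))                       ≡⟨ ℚ.*-identityʳ (fromℕ (length (arcs G))) ⟨
    fromℕ (length (arcs G)) * 1ℚ                  ≡⟨ Σ-const (arcs G) 1ℚ ⟨
    Σ[ arcs G ] (λ _ → 1ℚ)                        ≡⟨ Σ-arcs-source (λ _ → 1ℚ) ⟩
    Σ[ allFin n ] (λ u → fromℕ (deg G u) * 1ℚ)    ≡⟨ Σ-cong (allFin n) (λ u → ℚ.*-identityʳ (fromℕ (deg G u))) ⟩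
    Σ[ allFin n ] (λ u → fromℕ (deg G u))         ∎
    where open ≡-Reasoning

module RandomWalks {n : ℕ} (G : Graph n) (2≤n : 2 ≤ n) (conn : Connected G) where

  module Vertex = MarkovChain _≟ᶠ_ (allFin n) (Unique.allFin⁺ n) (Pv G)
  module Edge   = MarkovChain _≟ᵃ_ (arcs G) (arcs-unique G) (Pe G)

  neighbour : ∀ u → ∃ λ v → T (adj G u v)
  neighbour = connected⇒neighbour G 2≤n conn

  d d⁻¹ : Fin n → ℚ
  d   u = fromℕ (deg G u)
  d⁻¹ u = inv (deg G u)

  L L⁻¹ : ℚ
  L   = fromℕ (length (arcs G))
  L⁻¹ = inv (length (arcs G))

  d*d⁻¹ : ∀ u → d u * d⁻¹ u ≡ 1ℚ
  d*d⁻¹ u = fromℕ-*-inv (adj⇒0<deg G (proj₂ (neighbour u)))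

  v₀ : Fin n
  v₀ = Fin.fromℕ< {0} (ℕ.≤-trans (ℕ.s≤s ℕ.z≤n) 2≤n)

  arc₀∈ : (v₀ , proj₁ (neighbour v₀)) ∈ arcs G
  arc₀∈ = ∈-arcs⁺ G (proj₂ (neighbour v₀))

  L*L⁻¹ : L * L⁻¹ ≡ 1ℚ
  L*L⁻¹ = fromℕ-*-inv (∈⇒0<length arc₀∈)

  Σ-Pv : ∀ v (g : Fin n → ℚ) → Σ[ allFin n ] (λ k → Pv G v k * g k) ≡ d⁻¹ v * Σ[ neighbours G v ] g
  Σ-Pv v g = begin
    Σ[ allFin n ] (λ k → Pv G v k * g k)
      ≡⟨ Σ-cong (allFin n) (λ k → if-then-* (adj G v k) (d⁻¹ v) (g k)) ⟩
    Σ[ allFin n ] (λ k → if adj G v k then d⁻¹ v * g k else 0ℚ)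
      ≡⟨ Σ-filterᵇ (adj G v) (allFin n) (λ k → d⁻¹ v * g k) ⟨
    Σ[ neighbours G v ] (λ k → d⁻¹ v * g k)
      ≡⟨ Σ-*ˡ (neighbours G v) (d⁻¹ v) g ⟩
    d⁻¹ v * Σ[ neighbours G v ] g ∎
    where open ≡-Reasoning

  Σ-Pe : ∀ u v (f : Fin n × Fin n → ℚ) →
    Σ[ arcs G ] (λ a → Pe G (u , v) a * f a) ≡ d⁻¹ v * Σ[ neighbours G v ] (λ b → f (v , b))
  Σ-Pe u v f = begin
    Σ[ arcs G ] (λ a → Pe G (u , v) a * f a)
      ≡⟨ Σ-arcs G (λ a → Pe G (u , v) a * f a) ⟩
    Σ[ allFin n ] (λ a → Σ[ neighbours G a ] (λ b → (if does (a ≟ᶠ v) then d⁻¹ v else 0ℚ) * f (a , b)))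
      ≡⟨ Σ-cong (allFin n) (λ a → Σ-*ˡ (neighbours G a) (if does (a ≟ᶠ v) then d⁻¹ v else 0ℚ) (λ b → f (a , b))) ⟩
    Σ[ allFin n ] (λ a → (if does (a ≟ᶠ v) then d⁻¹ v else 0ℚ) * F a)
      ≡⟨ Σ-cong (allFin n) (λ a → if-then-* (does (a ≟ᶠ v)) (d⁻¹ v) (F a)) ⟩
    Σ[ allFin n ] (λ a → if does (a ≟ᶠ v) then d⁻¹ v * F a else 0ℚ)
      ≡⟨ Σ-δ _≟ᶠ_ (Unique.allFin⁺ n) (∈-allFin v) (λ a → d⁻¹ v * F a) ⟩
    d⁻¹ v * F v ∎
    where
    open ≡-Reasoning
    F : Fin n → ℚ
    F a = Σ[ neighbours G a ] (λ b → f (a , b))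

  degree-stationary : Vertex.Stationary (λ u → d u * L⁻¹)
  degree-stationary = Σπ≡1 , π≡πP
    where
    open ≡-Reasoning
    Σπ≡1 : Σ[ allFin n ] (λ u → d u * L⁻¹) ≡ 1ℚ
    Σπ≡1 = trans (Σ-*ʳ (allFin n) L⁻¹ d) (trans (cong (_* L⁻¹) (sym (handshake G))) L*L⁻¹)
    flow : ∀ j i → d i * L⁻¹ * Pv G i j ≡ (if adj G j i then L⁻¹ else 0ℚ)
    flow j i = trans (*-if-then (adj G i j) (d i * L⁻¹) (d⁻¹ i))
      (trans (cong (if adj G i j then_else 0ℚ) (cancel-inverse (d i) (d⁻¹ i) L⁻¹ (d*d⁻¹ i)))
             (cong (if_then L⁻¹ else 0ℚ) (symmetric G i j)))
      where
      cancel-inverse : ∀ a a⁻¹ c → a * a⁻¹ ≡ 1ℚ → a * c * a⁻¹ ≡ c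
      cancel-inverse a a⁻¹ c aa⁻¹≡1 = trans (rearrange a a⁻¹ c) (trans (cong (_* c) aa⁻¹≡1) (ℚ.*-identityˡ c))
        where
        rearrange : ∀ a a⁻¹ c → a * c * a⁻¹ ≡ a * a⁻¹ * c
        rearrange = solve-∀ ℚ-ring
    π≡πP : ∀ j → j ∈ allFin n → d j * L⁻¹ ≡ Σ[ allFin n ] (λ i → d i * L⁻¹ * Pv G i j)
    π≡πP j _ = sym (begin
      Σ[ allFin n ] (λ i → d i * L⁻¹ * Pv G i j)        ≡⟨ Σ-cong (allFin n) (flow j) ⟩
      Σ[ allFin n ] (λ i → if adj G j i then L⁻¹ else 0ℚ) ≡⟨ Σ-filterᵇ (adj G j) (allFin n) (λ _ → L⁻¹) ⟨
      Σ[ neighbours G j ] (λ _ → L⁻¹)                    ≡⟨ Σ-const (neighbours G j) L⁻¹ ⟩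
      d j * L⁻¹                                          ∎)

  Pe-nonneg : ∀ a b → a ∈ arcs G → b ∈ arcs G → 0ℚ ≤ℚ Pe G a b
  Pe-nonneg (u , v) (x , y) _ _ with does (x ≟ᶠ v)
  ... | true  = inv-nonneg (deg G v)
  ... | false = ℚ.≤-refl

  Pe-stochastic : ∀ a → a ∈ arcs G → Σ[ arcs G ] (Pe G a) ≡ 1ℚ
  Pe-stochastic (u , v) _ = begin
    Σ[ arcs G ] (Pe G (u , v))                ≡⟨ Σ-cong (arcs G) (λ a → ℚ.*-identityʳ (Pe G (u , v) a)) ⟨
    Σ[ arcs G ] (λ a → Pe G (u , v) a * 1ℚ)   ≡⟨ Σ-Pe u v (λ _ → 1ℚ) ⟩
    d⁻¹ v * Σ[ neighbours G v ] (λ _ → 1ℚ)    ≡⟨ cong (d⁻¹ v *_) (Σ-const (neighbours G v) 1ℚ) ⟩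
    d⁻¹ v * (d v * 1ℚ)                        ≡⟨ cong (d⁻¹ v *_) (ℚ.*-identityʳ (d v)) ⟩
    d⁻¹ v * d v                               ≡⟨ ℚ.*-comm (d⁻¹ v) (d v) ⟩
    d v * d⁻¹ v                               ≡⟨ d*d⁻¹ v ⟩
    1ℚ                                        ∎
    where open ≡-Reasoning

  arc-stationary : Edge.Stationary (λ _ → L⁻¹)
  arc-stationary = trans (Σ-const (arcs G) L⁻¹) L*L⁻¹ , π≡πP
    where
    open ≡-Reasoning
    π≡πP : ∀ b → b ∈ arcs G → L⁻¹ ≡ Σ[ arcs G ] (λ a → L⁻¹ * Pe G a b)
    π≡πP (x , y) _ = sym (begin
      Σ[ arcs G ] (λ a → L⁻¹ * Pe G a (x , y))
        ≡⟨ Σ-arcs-target G (λ v → L⁻¹ * (if does (x ≟ᶠ v) then d⁻¹ v else 0ℚ)) ⟩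
      Σ[ allFin n ] (λ v → d v * (L⁻¹ * (if does (x ≟ᶠ v) then d⁻¹ v else 0ℚ)))
        ≡⟨ Σ-cong (allFin n) (λ v → trans (cong (d v *_) (*-if-then (does (x ≟ᶠ v)) L⁻¹ (d⁻¹ v)))
                                          (*-if-then (does (x ≟ᶠ v)) (d v) (L⁻¹ * d⁻¹ v))) ⟩
      Σ[ allFin n ] (λ v → if does (x ≟ᶠ v) then d v * (L⁻¹ * d⁻¹ v) else 0ℚ)
        ≡⟨ Σ-δ′ _≟ᶠ_ (Unique.allFin⁺ n) (∈-allFin x) (λ v → d v * (L⁻¹ * d⁻¹ v)) ⟩
      d x * (L⁻¹ * d⁻¹ x)    ≡⟨ rearrange (d x) L⁻¹ (d⁻¹ x) ⟩
      (d x * d⁻¹ x) * L⁻¹    ≡⟨ cong (_* L⁻¹) (d*d⁻¹ x) ⟩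
      1ℚ * L⁻¹               ≡⟨ ℚ.*-identityˡ L⁻¹ ⟩
      L⁻¹                    ∎)
      where
      rearrange : ∀ a c a⁻¹ → a * (c * a⁻¹) ≡ (a * a⁻¹) * c
      rearrange = solve-∀ ℚ-ring

  Pe-pos : ∀ {u v b} → T (adj G v b) → 0ℚ < Pe G (u , v) (v , b)
  Pe-pos {v = v} v~b = subst (0ℚ <_) (sym (if-≟-≡ _≟ᶠ_ {v} refl)) (inv-pos (adj⇒0<deg G v~b))

  arc-path : ∀ {u v x y} → T (adj G x y) → Reach G v x → Edge.Path (u , v) (x , y)
  arc-path {u} x~y here           = Edge.step (∈-arcs⁺ G x~y) (Pe-pos {u} x~y) Edge.done
  arc-path {u} x~y (step v~w w⇝x) = Edge.step (∈-arcs⁺ G v~w) (Pe-pos {u} v~w) (arc-path x~y w⇝x)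

  arcs-connected : ∀ a b → a ∈ arcs G → b ∈ arcs G → Edge.Path a b
  arcs-connected (u , v) (x , y) _ xy∈ = arc-path (∈-arcs⁻ G xy∈) (conn v x)

  module FirstPassageTimes {M : Fin n → Fin n → ℚ} (fp : Vertex.FirstPassage M) where

    M₀ : Fin n → Fin n → ℚ
    M₀ = Vertex.offDiag M

    passageFromNeighbours : Fin n → Fin n → ℚ
    passageFromNeighbours v x = Σ[ neighbours G v ] (λ b → M₀ b x)

    vertex-firstPassage : ∀ {v x} → v ≢ x → M₀ v x ≡ 1ℚ + d⁻¹ v * passageFromNeighbours v x
    vertex-firstPassage {v} {x} v≢x = trans (if-≟-≢ _≟ᶠ_ v≢x)
      (trans (Vertex.firstPassage-offDiag fp (∈-allFin v) (∈-allFin x) v≢x) (cong (1ℚ +_) (Σ-Pv v (λ k → M₀ k x))))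

    -- Kac's formula for the degree distribution: the mean return time to x is L / d x.
    passageFromNeighbours-return : ∀ x → passageFromNeighbours x x ≡ L - d x
    passageFromNeighbours-return x = solve-for {d x} {d⁻¹ x} {L} {L⁻¹} (d*d⁻¹ x) L*L⁻¹
      (trans (cong (λ r → d x * L⁻¹ * (1ℚ + r)) (sym (Σ-Pv x (λ k → M₀ k x))))
             (Vertex.stationary-*-returnTime degree-stationary fp (∈-allFin x)))
      where
      solve-for : ∀ {a a⁻¹ l l⁻¹ s} → a * a⁻¹ ≡ 1ℚ → l * l⁻¹ ≡ 1ℚ → a * l⁻¹ * (1ℚ + a⁻¹ * s) ≡ 1ℚ → s ≡ l - a
      solve-for {a} {a⁻¹} {l} {l⁻¹} {s} aa⁻¹≡1 ll⁻¹≡1 eq = sym (trans (cong (_- a) l≡a+s) (collapse a s))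
        where
        open ≡-Reasoning
        expand : ∀ a a⁻¹ l l⁻¹ s → l * (a * l⁻¹ * (1ℚ + a⁻¹ * s)) ≡ (l * l⁻¹) * (a + (a * a⁻¹) * s)
        expand = solve-∀ ℚ-ring
        collapse : ∀ a s → 1ℚ * (a + 1ℚ * s) - a ≡ s
        collapse = solve-∀ ℚ-ring
        l≡a+s : l ≡ 1ℚ * (a + 1ℚ * s)
        l≡a+s = begin
          l                                   ≡⟨ ℚ.*-identityʳ l ⟨
          l * 1ℚ                              ≡⟨ cong (l *_) eq ⟨
          l * (a * l⁻¹ * (1ℚ + a⁻¹ * s))      ≡⟨ expand a a⁻¹ l l⁻¹ s ⟩
          (l * l⁻¹) * (a + (a * a⁻¹) * s)     ≡⟨ cong₂ (λ p q → p * (a + q * s)) ll⁻¹≡1 aa⁻¹≡1 ⟩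
          1ℚ * (a + 1ℚ * s)                   ∎

    -- From arc (u , v) the walk first reaches x, after M₀ v x steps; the further wait until
    -- (x , y) is traversed is the return time L of the arc (x , y) (Kac, for the uniform arc
    -- distribution) minus the M₀ y x steps that such a return spends going from y back to x.
    Me : Fin n × Fin n → Fin n × Fin n → ℚ
    Me (u , v) (x , y) = M₀ v x + L - M₀ y x

    Me-diag : ∀ a → Me a a ≡ L
    Me-diag (u , v) = cancel (M₀ v u) L
      where
      cancel : ∀ m l → m + l - m ≡ l
      cancel = solve-∀ ℚ-ring

    Σ-Pe-Me : ∀ u v x y → (x , y) ∈ arcs G →
      Edge.Σ≠ (x , y) (λ a → Pe G (u , v) a * Me a (x , y))
        ≡ d⁻¹ v * (passageFromNeighbours v x + d v * (L - M₀ y x)) - (if does (x ≟ᶠ v) then d⁻¹ v else 0ℚ) * L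
    Σ-Pe-Me u v x y xy∈ = begin
      Edge.Σ≠ (x , y) (λ a → Pe G (u , v) a * Me a (x , y))
        ≡⟨ Edge.Σ≠≡Σ- xy∈ (λ a → Pe G (u , v) a * Me a (x , y)) ⟩
      Σ[ arcs G ] (λ a → Pe G (u , v) a * Me a (x , y)) - Pe G (u , v) (x , y) * Me (x , y) (x , y)
        ≡⟨ cong₂ _-_ (Σ-Pe u v (λ a → Me a (x , y))) (cong (Pe G (u , v) (x , y) *_) (Me-diag (x , y))) ⟩
      d⁻¹ v * Σ[ neighbours G v ] (λ b → M₀ b x + L - M₀ y x) - Pe G (u , v) (x , y) * L
        ≡⟨ cong (λ s → d⁻¹ v * s - Pe G (u , v) (x , y) * L) Σ-neighbours ⟩
      d⁻¹ v * (passageFromNeighbours v x + d v * (L - M₀ y x)) - Pe G (u , v) (x , y) * L ∎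
      where
      open ≡-Reasoning
      reassociate : ∀ m l c → m + l - c ≡ m + (l - c)
      reassociate = solve-∀ ℚ-ring
      Σ-neighbours : Σ[ neighbours G v ] (λ b → M₀ b x + L - M₀ y x) ≡ passageFromNeighbours v x + d v * (L - M₀ y x)
      Σ-neighbours = trans (Σ-cong (neighbours G v) (λ b → reassociate (M₀ b x) L (M₀ y x)))
        (trans (Σ-+ (neighbours G v) (λ b → M₀ b x) (λ _ → L - M₀ y x))
               (cong (passageFromNeighbours v x +_) (Σ-const (neighbours G v) (L - M₀ y x))))

    arc-firstPassage : Edge.FirstPassage Me
    arc-firstPassage (u , v) (x , y) _ xy∈ _ with x ≟ᶠ v
    ... | yes refl = sym (begin
      1ℚ + Edge.Σ≠ (x , y) (λ a → Pe G (u , x) a * Me a (x , y))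
        ≡⟨ cong (1ℚ +_) (Σ-Pe-Me u x x y xy∈) ⟩
      1ℚ + (d⁻¹ x * (passageFromNeighbours x x + d x * (L - M₀ y x)) - (if does (x ≟ᶠ x) then d⁻¹ x else 0ℚ) * L)
        ≡⟨ cong₂ (λ s p → 1ℚ + (d⁻¹ x * (s + d x * (L - M₀ y x)) - p * L))
                 (passageFromNeighbours-return x) (if-≟-≡ _≟ᶠ_ {x} refl) ⟩
      1ℚ + (d⁻¹ x * ((L - d x) + d x * (L - M₀ y x)) - d⁻¹ x * L)
        ≡⟨ expand (d x) (d⁻¹ x) L (M₀ y x) ⟩
      1ℚ - d x * d⁻¹ x + d x * d⁻¹ x * (L - M₀ y x)
        ≡⟨ cong (λ t → 1ℚ - t + t * (L - M₀ y x)) (d*d⁻¹ x) ⟩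
      1ℚ - 1ℚ + 1ℚ * (L - M₀ y x)
        ≡⟨ collapse L (M₀ y x) ⟩
      0ℚ + L - M₀ y x
        ≡⟨ cong (λ m → m + L - M₀ y x) (if-≟-≡ _≟ᶠ_ {x} refl) ⟨
      Me (u , x) (x , y) ∎)
      where
      open ≡-Reasoning
      expand : ∀ a a⁻¹ l c → 1ℚ + (a⁻¹ * ((l - a) + a * (l - c)) - a⁻¹ * l) ≡ 1ℚ - a * a⁻¹ + a * a⁻¹ * (l - c)
      expand = solve-∀ ℚ-ring
      collapse : ∀ l c → 1ℚ - 1ℚ + 1ℚ * (l - c) ≡ 0ℚ + l - c
      collapse = solve-∀ ℚ-ring
    ... | no x≢v = sym (begin
      1ℚ + Edge.Σ≠ (x , y) (λ a → Pe G (u , v) a * Me a (x , y))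
        ≡⟨ cong (1ℚ +_) (Σ-Pe-Me u v x y xy∈) ⟩
      1ℚ + (d⁻¹ v * (S + d v * (L - M₀ y x)) - (if does (x ≟ᶠ v) then d⁻¹ v else 0ℚ) * L)
        ≡⟨ cong (λ p → 1ℚ + (d⁻¹ v * (S + d v * (L - M₀ y x)) - p * L)) (if-≟-≢ _≟ᶠ_ x≢v) ⟩
      1ℚ + (d⁻¹ v * (S + d v * (L - M₀ y x)) - 0ℚ * L)
        ≡⟨ expand (d v) (d⁻¹ v) S L (M₀ y x) ⟩
      1ℚ + d⁻¹ v * S + d v * d⁻¹ v * (L - M₀ y x)
        ≡⟨ cong (λ t → 1ℚ + d⁻¹ v * S + t * (L - M₀ y x)) (d*d⁻¹ v) ⟩
      1ℚ + d⁻¹ v * S + 1ℚ * (L - M₀ y x)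
        ≡⟨ collapse (d⁻¹ v) S L (M₀ y x) ⟩
      (1ℚ + d⁻¹ v * S) + L - M₀ y x
        ≡⟨ cong (λ m → m + L - M₀ y x) (vertex-firstPassage (λ v≡x → x≢v (sym v≡x))) ⟨
      Me (u , v) (x , y) ∎)
      where
      open ≡-Reasoning
      S = passageFromNeighbours v x
      expand : ∀ a a⁻¹ s l c → 1ℚ + (a⁻¹ * (s + a * (l - c)) - 0ℚ * l) ≡ 1ℚ + a⁻¹ * s + a * a⁻¹ * (l - c)
      expand = solve-∀ ℚ-ring
      collapse : ∀ a⁻¹ s l c → 1ℚ + a⁻¹ * s + 1ℚ * (l - c) ≡ (1ℚ + a⁻¹ * s) + l - c
      collapse = solve-∀ ℚ-ring

    Σ-Me : ∀ u v → Σ[ arcs G ] (Me (u , v)) ≡ Σ[ allFin n ] (λ x → d x * M₀ v x) + L * L - (fromℕ n * L - L)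
    Σ-Me u v = begin
      Σ[ arcs G ] (λ a → M₀ v (proj₁ a) + L - M₀ (proj₂ a) (proj₁ a))
        ≡⟨ Σ-- (arcs G) (λ a → M₀ v (proj₁ a) + L) (λ a → M₀ (proj₂ a) (proj₁ a)) ⟩
      Σ[ arcs G ] (λ a → M₀ v (proj₁ a) + L) - Σ[ arcs G ] (λ a → M₀ (proj₂ a) (proj₁ a))
        ≡⟨ cong₂ _-_ (Σ-+ (arcs G) (λ a → M₀ v (proj₁ a)) (λ _ → L)) (Σ-arcs G (λ a → M₀ (proj₂ a) (proj₁ a))) ⟩
      Σ[ arcs G ] (λ a → M₀ v (proj₁ a)) + Σ[ arcs G ] (λ _ → L) - Σ[ allFin n ] (λ x → passageFromNeighbours x x)
        ≡⟨ cong₂ (λ p q → p + q - Σ[ allFin n ] (λ x → passageFromNeighbours x x)) (Σ-arcs-source G (M₀ v)) (Σ-const (arcs G) L) ⟩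
      Σ[ allFin n ] (λ x → d x * M₀ v x) + L * L - Σ[ allFin n ] (λ x → passageFromNeighbours x x)
        ≡⟨ cong (λ r → Σ[ allFin n ] (λ x → d x * M₀ v x) + L * L - r) Σ-return ⟩
      Σ[ allFin n ] (λ x → d x * M₀ v x) + L * L - (fromℕ n * L - L) ∎
      where
      open ≡-Reasoning
      Σ-return : Σ[ allFin n ] (λ x → passageFromNeighbours x x) ≡ fromℕ n * L - L
      Σ-return = begin
        Σ[ allFin n ] (λ x → passageFromNeighbours x x)  ≡⟨ Σ-cong (allFin n) passageFromNeighbours-return ⟩
        Σ[ allFin n ] (λ x → L - d x)                   ≡⟨ Σ-- (allFin n) (λ _ → L) d ⟩
        Σ[ allFin n ] (λ _ → L) - Σ[ allFin n ] d
          ≡⟨ cong₂ _-_ (trans (Σ-const (allFin n) L) (cong (λ k → fromℕ k * L) (length-tabulate {n = n} id))) (sym (handshake G)) ⟩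
        fromℕ n * L - L ∎

    Σ-d*M₀ : ∀ {K} v → Σ[ allFin n ] (λ x → M₀ v x * (d x * L⁻¹)) ≡ K → Σ[ allFin n ] (λ x → d x * M₀ v x) ≡ L * K
    Σ-d*M₀ {K} v ΣM₀π≡K = begin
      Σ[ allFin n ] (λ x → d x * M₀ v x)                ≡⟨ Σ-cong (allFin n) (λ x → pointwise (d x) (M₀ v x)) ⟩
      Σ[ allFin n ] (λ x → L * (M₀ v x * (d x * L⁻¹)))  ≡⟨ Σ-*ˡ (allFin n) L (λ x → M₀ v x * (d x * L⁻¹)) ⟩
      L * Σ[ allFin n ] (λ x → M₀ v x * (d x * L⁻¹))    ≡⟨ cong (L *_) ΣM₀π≡K ⟩
      L * K                                             ∎
      where
      open ≡-Reasoning
      rearrange : ∀ a m l l⁻¹ → l * (m * (a * l⁻¹)) ≡ (l * l⁻¹) * (a * m)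
      rearrange = solve-∀ ℚ-ring
      pointwise : ∀ a m → a * m ≡ L * (m * (a * L⁻¹))
      pointwise a m = sym (trans (rearrange a m L L⁻¹) (trans (cong (_* (a * m)) L*L⁻¹) (ℚ.*-identityˡ (a * m))))

    arc-kemeny : ∀ {K u v} → (u , v) ∈ arcs G → Σ[ allFin n ] (λ x → M₀ v x * (d x * L⁻¹)) ≡ K →
      Edge.Σ≠ (u , v) (λ a → Me (u , v) a * L⁻¹) ≡ K + (L - fromℕ n)
    arc-kemeny {K} {u} {v} uv∈ ΣM₀π≡K = begin
      Edge.Σ≠ (u , v) (λ a → Me (u , v) a * L⁻¹)
        ≡⟨ Edge.Σ≠≡Σ- uv∈ (λ a → Me (u , v) a * L⁻¹) ⟩
      Σ[ arcs G ] (λ a → Me (u , v) a * L⁻¹) - Me (u , v) (u , v) * L⁻¹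
        ≡⟨ cong₂ (λ p q → p - q * L⁻¹) (trans (Σ-*ʳ (arcs G) L⁻¹ (Me (u , v))) (cong (_* L⁻¹) (Σ-Me u v))) (Me-diag (u , v)) ⟩
      (Σ[ allFin n ] (λ x → d x * M₀ v x) + L * L - (fromℕ n * L - L)) * L⁻¹ - L * L⁻¹
        ≡⟨ cong (λ p → (p + L * L - (fromℕ n * L - L)) * L⁻¹ - L * L⁻¹) (Σ-d*M₀ v ΣM₀π≡K) ⟩
      (L * K + L * L - (fromℕ n * L - L)) * L⁻¹ - L * L⁻¹
        ≡⟨ expand L L⁻¹ K (fromℕ n) ⟩
      L * L⁻¹ * (K + (L - fromℕ n) + 1ℚ) - L * L⁻¹
        ≡⟨ cong (λ t → t * (K + (L - fromℕ n) + 1ℚ) - t) L*L⁻¹ ⟩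
      1ℚ * (K + (L - fromℕ n) + 1ℚ) - 1ℚ
        ≡⟨ collapse (K + (L - fromℕ n)) ⟩
      K + (L - fromℕ n) ∎
      where
      open ≡-Reasoning
      expand : ∀ l l⁻¹ k m → (l * k + l * l - (m * l - l)) * l⁻¹ - l * l⁻¹ ≡ l * l⁻¹ * (k + (l - m) + 1ℚ) - l * l⁻¹
      expand = solve-∀ ℚ-ring
      collapse : ∀ k → 1ℚ * (k + 1ℚ) - 1ℚ ≡ k
      collapse = solve-∀ ℚ-ring

  edge-kemeny : ∀ {Kv} → Vertex.IsKemeny Kv → Edge.IsKemeny (Kv + (L - fromℕ n))
  edge-kemeny {Kv} (π , M , stat , fp , K≡) =
    (λ _ → L⁻¹) , Me , arc-stationary , arc-firstPassage , λ { (u , v) uv∈ → arc-kemeny uv∈ (vertex-kemeny v) }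
    where
    open FirstPassageTimes fp
    open ≡-Reasoning
    vertex-kemeny : ∀ v → Σ[ allFin n ] (λ x → M₀ v x * (d x * L⁻¹)) ≡ Kv
    vertex-kemeny v = begin
      Σ[ allFin n ] (λ x → M₀ v x * (d x * L⁻¹))
        ≡⟨ Σ-cong (allFin n) (λ x → cong (M₀ v x *_) (Vertex.stationary-unique degree-stationary stat fp (∈-allFin x))) ⟩
      Σ[ allFin n ] (λ x → M₀ v x * π x)  ≡⟨ Vertex.Σ≠-offDiagʳ v π M ⟨
      Vertex.Σ≠ v (λ x → M v x * π x)     ≡⟨ K≡ v (∈-allFin v) ⟩
      Kv                                  ∎

  edge-kemeny-unique : ∀ {K₁ K₂} → Edge.IsKemeny K₁ → Edge.IsKemeny K₂ → K₁ ≡ K₂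
  edge-kemeny-unique isKemeny₁ isKemeny₂ =
    Edge.Irreducible.kemeny-unique Pe-nonneg Pe-stochastic arcs-connected isKemeny₁ isKemeny₂ arc₀∈

theorem2p9 : ∀ {n : ℕ} (G : Graph n) → 2 ≤ n → Connected G →
    ∀ (Kv : ℚ) → IsKemenyV G Kv →
      IsKemenyE G (Kv + twoM-n G) × (∀ (Ke : ℚ) → IsKemenyE G Ke → Ke ≡ Kv + twoM-n G)
theorem2p9 {n} G 2≤n conn Kv isKemenyV =
  subst (λ c → IsKemenyE G (Kv + c)) L-n≡2m-n edge ,
  λ Ke isKemenyE → trans (edge-kemeny-unique isKemenyE edge) (cong (Kv +_) L-n≡2m-n)
  where
  open RandomWalks G 2≤n conn
  edge : IsKemenyE G (Kv + (L - fromℕ n))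
  edge = edge-kemeny isKemenyV
  L-n≡2m-n : L - fromℕ n ≡ twoM-n G
  L-n≡2m-n = sym (fromℤ-sub (length (arcs G)) n)
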